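{- Let $r$ be a positive integer, let $F:\mathbf{Set}^r\to\mathbf{Set}$ be an $r$-sort species, and let $\eta$ be a composition operator for $F$. Then for all $k,\ell\in\mathbb{N}_0$ with $k\ne\ell$ and every $\Omega\in\mathrm{Obj}(\mathbf{Set}^r)$, \[ F^{(k)}_\eta[\Omega]\cap F^{(\ell)}_\eta[\Omega]=\emptyset. \]
   Context: $\mathbf{Set}$ is the category of finite sets and bijections. An object $\Omega=(\Omega^{(1)},\dots,\Omega^{(r)})$ of $\mathbf{Set}^r$ is an $r$-tuple of finite sets. Set operations on such tuples are componentwise, and $\boldsymbol\emptyset=(\emptyset,\dots,\emptyset)$. $\mathfrak{D}_r$ denotes the class of pairs $(\Omega_1,\Omega_2)$ of objects with $\Omega_1\cap\Omega_2=\boldsymbol\emptyset$. An $r$-sort species is a functor $F:\mathbf{Set}^r\to\mathbf{Set}$. A composition operator for $F$ is a family of injective maps $\eta_{(\Omega_1,\Omega_2)}:F[\Omega_1]\times F[\Omega_2]\to F[\Omega_1\amalg\Omega_2]$, $(\Omega_1,\Omega_2)\in\mathfrak{D}_r$, with the following two properties. - Naturality: $\eta_{(\tilde\Omega_1,\tilde\Omega_2)}\circ(F[f_1]\times F[f_2])=F[f_1\amalg f_2]\circ\eta_{(\Omega_1,\Omega_2)}$ for all tuples of bijections $f_i:\Omega_i\to\tilde\Omega_i$. - Axiom (D1): whenever $\Omega_1\amalg\Omega_2=\Omega=\tilde\Omega_1\amalg\tilde\Omega_2$ with both pairs disjoint, \[ \eta(F[\Omega_1]\times F[\Omega_2])\cap\eta(F[\tilde\Omega_1]\times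 F[\tilde\Omega_2])=\eta(\eta(F[\Omega_{11}]\times F[\Omega_{12}])\times\eta(F[\Omega_{21}]\times F[\Omega_{22}])), \] where $\Omega_{ij}=\Omega_i\cap\tilde\Omega_j$. Here $\eta(A\times B)$ denotes the image of $A\times B$ under the relevant $\eta$-map. Define $F_\eta[\boldsymbol\emptyset]=\emptyset$ and, for $\Omega\ne\boldsymbol\emptyset$, $F_\eta[\Omega]=F[\Omega]-\bigcup\eta(F[I]\times F[J])$, the union over disjoint pairs $(I,J)$ with $I\amalg J=\Omega$ and $I\ne\boldsymbol\emptyset\ne J$. Define $F^{(0)}_\eta[\boldsymbol\emptyset]=F[\boldsymbol\emptyset]$ and $F^{(0)}_\eta[\Omega]=\emptyset$ for $\Omega\ne\boldsymbol\emptyset$. For $k\ge1$, define \[ F^{(k)}_\eta[\Omega]=\bigcup_{\Omega_1\subseteq\Omega}\eta(F_\eta[\Omega_1]\times F^{(k-1)}_\eta[\Omega-\Omega_1]). \] -}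

module Defs where

open import Level using (0ℓ)
open import Data.Nat using (ℕ; zero; suc)
open import Data.Fin using (Fin)
open import Data.Fin.Subset as S using (Subset)
open import Data.Vec using (Vec; lookup; zipWith; replicate)
open import Data.Vec.Relation.Binary.Pointwise.Inductive using (Pointwise)
open import Data.Product using (Σ; Σ-syntax; _×_; proj₁)
open import Function.Bundles using (_↔_; Inverse; _⇔_)
open import Function.Construct.Identity using (↔-id)
open import Function.Construct.Composition using (_↔-∘_)
open import Relation.Binary.PropositionalEquality using (_≡_; _≢_; subst)
open import Relation.Nullary using (¬_)
open import Data.Unit using (⊤)

-- Finite sets are modelled as finite subsets of a
-- fixed (but arbitrary) ambient finite universe Fin N, so that union,
-- intersection, difference and disjointness are the genuine set
-- operations and equality of objects is propositional equality.

Obj : ℕ → ℕ → Set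
Obj r N = Vec (Subset N) r

module _ {r N : ℕ} where

  ∅ᵒ : Obj r N
  ∅ᵒ = replicate r S.⊥

  infixr 6 _∪ᵒ_ _∩ᵒ_ _-ᵒ_
  _∪ᵒ_ _∩ᵒ_ _-ᵒ_ : Obj r N → Obj r N → Obj r N
  A ∪ᵒ B = zipWith S._∪_ A B
  A ∩ᵒ B = zipWith S._∩_ A B
  A -ᵒ B = zipWith S._─_ A B

  _⊆ᵒ_ : Obj r N → Obj r N → Set
  A ⊆ᵒ B = Pointwise S._⊆_ A B

  Disjoint : Obj r N → Obj r N → Set
  Disjoint A B = A ∩ᵒ B ≡ ∅ᵒ

  El : Obj r N → Fin r → Set
  El Ω i = Σ[ x ∈ Fin N ] x S.∈ lookup Ω i

  record Bij (Ω Ω' : Obj r N) : Set where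
    constructor bij
    field
      iso : (i : Fin r) → El Ω i ↔ El Ω' i

    app : (i : Fin r) → El Ω i → El Ω' i
    app i = Inverse.to (iso i)

  open Bij public

  idB : (Ω : Obj r N) → Bij Ω Ω
  idB Ω = bij (λ i → ↔-id (El Ω i))

  _∘B_ : {Ω Ω' Ω'' : Obj r N} → Bij Ω' Ω'' → Bij Ω Ω' → Bij Ω Ω''
  g ∘B f = bij (λ i → iso g i ↔-∘ iso f i)

  _≈B_ : {Ω Ω' : Obj r N} → Bij Ω Ω' → Bij Ω Ω' → Set
  f ≈B g = ∀ i x → app f i x ≡ app g i x

record Species (r N : ℕ) : Set₁ where
  field
    F₀     : Obj r N → Set
    F₁     : {Ω Ω' : Obj r N} → Bij Ω Ω' → F₀ Ω → F₀ Ω'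
    F-id   : (Ω : Obj r N) (x : F₀ Ω) → F₁ (idB Ω) x ≡ x
    F-∘    : {Ω Ω' Ω'' : Obj r N} (g : Bij Ω' Ω'') (f : Bij Ω Ω')
             (x : F₀ Ω) → F₁ (g ∘B f) x ≡ F₁ g (F₁ f x)
    F-cong : {Ω Ω' : Obj r N} {f g : Bij Ω Ω'} → f ≈B g →
             (x : F₀ Ω) → F₁ f x ≡ F₁ g x
    finite : (Ω : Obj r N) → Σ[ n ∈ ℕ ] (F₀ Ω ↔ Fin n)

EtaType : {r N : ℕ} → (Obj r N → Set) → Set
EtaType {r} {N} F = {I J : Obj r N} → .(Disjoint I J) → F I → F J → F (I ∪ᵒ J)

-- x ∈ η(P × Q) ⊆ F[Ω], where P ⊆ F[I], Q ⊆ F[J], (I , J) ∈ 𝔇_r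
-- and I ∐ J = Ω.
Img : {r N : ℕ} (F : Obj r N → Set) (η : EtaType F)
      (Ω I J : Obj r N) (P : F I → Set) (Q : F J → Set) → F Ω → Set
Img F η Ω I J P Q x =
  Σ[ d ∈ Disjoint I J ] Σ[ e ∈ I ∪ᵒ J ≡ Ω ] Σ[ a ∈ F I ] Σ[ b ∈ F J ]
    (P a × Q b × subst F e (η d a b) ≡ x)

Full : {A : Set} → A → Set
Full _ = ⊤

-- g = f₁ ∐ f₂ : Ω₁ ∐ Ω₂ → Ω̃₁ ∐ Ω̃₂ , i.e. g acts as f₁ on Ω₁ and as f₂ on Ω₂
_≐_∐_ : {r N : ℕ} {I J I' J' : Obj r N} →
        Bij (I ∪ᵒ J) (I' ∪ᵒ J') → Bij I I' → Bij J J' → Set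
_≐_∐_ {r} {N} {I} {J} g f₁ f₂ =
  ((i : Fin r) (x : El (I ∪ᵒ J) i) (y : El I i) →
     proj₁ x ≡ proj₁ y → proj₁ (app g i x) ≡ proj₁ (app f₁ i y)) ×
  ((i : Fin r) (x : El (I ∪ᵒ J) i) (y : El J i) →
     proj₁ x ≡ proj₁ y → proj₁ (app g i x) ≡ proj₁ (app f₂ i y))

record CompositionOperator {r N : ℕ} (Sp : Species r N) : Set₁ where
  open Species Sp
  field
    η : EtaType F₀
    η-injective : {I J : Obj r N} .(d : Disjoint I J) {a a' : F₀ I} {b b' : F₀ J} →
                  η d a b ≡ η d a' b' → (a ≡ a') × (b ≡ b')
    η-natural : {I J I' J' : Obj r N} .(d : Disjoint I J) .(d' : Disjoint I' J')
                (f₁ : Bij I I') (f₂ : Bij J J') (g : Bij (I ∪ᵒ J) (I' ∪ᵒ J')) →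
                g ≐ f₁ ∐ f₂ → (a : F₀ I) (b : F₀ J) →
                η d' (F₁ f₁ a) (F₁ f₂ b) ≡ F₁ g (η d a b)
    D1 : {Ω Ω₁ Ω₂ Ω̃₁ Ω̃₂ : Obj r N} →
         Disjoint Ω₁ Ω₂ → Ω₁ ∪ᵒ Ω₂ ≡ Ω →
         Disjoint Ω̃₁ Ω̃₂ → Ω̃₁ ∪ᵒ Ω̃₂ ≡ Ω →
         (x : F₀ Ω) →
         (Img F₀ η Ω Ω₁ Ω₂ Full Full x × Img F₀ η Ω Ω̃₁ Ω̃₂ Full Full x)
         ⇔ Img F₀ η Ω Ω₁ Ω₂
             (Img F₀ η Ω₁ (Ω₁ ∩ᵒ Ω̃₁) (Ω₁ ∩ᵒ Ω̃₂) Full Full)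
             (Img F₀ η Ω₂ (Ω₂ ∩ᵒ Ω̃₁) (Ω₂ ∩ᵒ Ω̃₂) Full Full) x

module Derived {r N : ℕ} (Sp : Species r N) (C : CompositionOperator Sp) where
  open Species Sp
  open CompositionOperator C

  Fη : (Ω : Obj r N) → F₀ Ω → Set
  Fη Ω x = (Ω ≢ ∅ᵒ) ×
           ¬ (Σ[ I ∈ Obj r N ] Σ[ J ∈ Obj r N ]
                (I ≢ ∅ᵒ) × (J ≢ ∅ᵒ) × Img F₀ η Ω I J Full Full x)

  Fηᵏ : ℕ → (Ω : Obj r N) → F₀ Ω → Set
  Fηᵏ zero    Ω x = Ω ≡ ∅ᵒ
  Fηᵏ (suc k) Ω x =
    Σ[ Ω₁ ∈ Obj r N ] (Ω₁ ⊆ᵒ Ω) ×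
      Img F₀ η Ω Ω₁ (Ω -ᵒ Ω₁) (Fη Ω₁) (Fηᵏ k (Ω -ᵒ Ω₁)) x

module Submission where

-- An element x ∈ F[Ω] determines the blocks of any decomposition of it
-- into F_η-factors.  Call Y ⊆ Ω a splitting set of x if
-- x ∈ η(F[Y] × F[Ω − Y]), and an atom of x a nonempty splitting set with
-- no nonempty proper splitting subset.  Axiom (D1) makes splitting sets
-- closed under intersection, so two atoms of x are equal or disjoint.  This
-- uses an element e₀ ∈ F[∅] (present as soon as some level is inhabited):
-- by injectivity of η and finiteness of F[X], every c ∈ F[X] is η(e₀, u).
-- An element x = η(a, y) of F^(k+1)_η[Ω] with a ∈ F_η[A] has A as an atom,
-- and y has the same splitting sets inside Ω − A as x; unfolding k times
-- partitions Ω into k atoms of x.  By an exchange argument all atom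
-- partitions of a set have the same size, hence k = ℓ.

open import Defs
open import Data.Nat using (ℕ; zero; suc; _<_)
import Data.Nat.Properties as ℕ
open import Data.Fin using (Fin; zero; suc; punchOut; _≟_)
open import Data.Fin.Properties using (any?; injective⇒≤; punchOut-injective)
open import Data.Fin.Subset as S using (Subset)
open import Data.Bool using (Bool; true; false; _∧_; _∨_; not; _≤_; b≤b; f≤t) renaming (_≟_ to _≟ᵇ_)
open import Data.Bool.Properties using (∧-zeroʳ; ∧-identityʳ; ∧-comm; ≤-antisym; ≤-refl; ≤-trans; ≤-minimum)
open import Data.Vec using (_∷_; lookup; tabulate)
open import Data.Vec.Properties using (lookup-zipWith; lookup-replicate; tabulate∘lookup; tabulate-cong; lookup⇒[]=; []=⇒lookup; ≡-dec)
import Data.Vec.Relation.Binary.Pointwise.Inductive as Pointwise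
open import Data.Product using (∃-syntax; Σ-syntax; _×_; _,_; proj₁; proj₂; map)
open import Data.Sum using (_⊎_; inj₁; inj₂)
open import Data.Empty using (⊥; ⊥-elim)
open import Data.Unit using (tt)
open import Function.Bundles using (_↔_; Inverse; Injection; Equivalence)
open import Function.Definitions using (Injective)
open import Function.Properties.Inverse using (↔⇒↣)
open import Function.Construct.Symmetry using (↔-sym)
open import Relation.Binary.Definitions using (DecidableEquality)
open import Relation.Binary.PropositionalEquality
open import Relation.Binary.PropositionalEquality.Properties using (subst-injective)
open import Relation.Nullary using (¬_; yes; no; contradiction)
open import Relation.Nullary.Decidable using (decidable-stable)
open import Axiom.UniquenessOfIdentityProofs using (module Decidable⇒UIP)

-- Objects are r-tuples of subsets of Fin N.  Every identity or inclusion
-- between objects used below is verified bit by bit, where it becomes a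
-- small Boolean fact proved by case analysis.
module _ {r N : ℕ} where

  _≟ᵒ_ : DecidableEquality (Obj r N)
  _≟ᵒ_ = ≡-dec (≡-dec _≟ᵇ_)

  bit : Obj r N → Fin r → Fin N → Bool
  bit A i j = lookup (lookup A i) j

  lookup-─ : ∀ {n} (p q : Subset n) j → lookup (p S.─ q) j ≡ lookup p j ∧ not (lookup q j)
  lookup-─ (a ∷ p) (true ∷ q) zero = sym (∧-zeroʳ a)
  lookup-─ (a ∷ p) (false ∷ q) zero = sym (∧-identityʳ a)
  lookup-─ (_ ∷ p) (_ ∷ q) (suc j) = lookup-─ p q j

  bit-∩ : ∀ A B i j → bit (A ∩ᵒ B) i j ≡ bit A i j ∧ bit B i j
  bit-∩ A B i j rewrite lookup-zipWith S._∩_ i A B = lookup-zipWith _∧_ j (lookup A i) (lookup B i)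

  bit-∪ : ∀ A B i j → bit (A ∪ᵒ B) i j ≡ bit A i j ∨ bit B i j
  bit-∪ A B i j rewrite lookup-zipWith S._∪_ i A B = lookup-zipWith _∨_ j (lookup A i) (lookup B i)

  bit-─ : ∀ A B i j → bit (A -ᵒ B) i j ≡ bit A i j ∧ not (bit B i j)
  bit-─ A B i j rewrite lookup-zipWith S._─_ i A B = lookup-─ (lookup A i) (lookup B i) j

  bit-∅ : ∀ i j → bit ∅ᵒ i j ≡ false
  bit-∅ i j rewrite lookup-replicate {n = r} i (S.⊥ {N}) = lookup-replicate j false

  obj-ext : {A B : Obj r N} → (∀ i j → bit A i j ≡ bit B i j) → A ≡ B
  obj-ext {A} {B} same = begin
    A                            ≡⟨ tabulate∘lookup A ⟨
    tabulate (λ i → lookup A i)  ≡⟨ tabulate-cong row ⟩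
    tabulate (λ i → lookup B i)  ≡⟨ tabulate∘lookup B ⟩
    B                            ∎
    where
    open ≡-Reasoning
    row : ∀ i → lookup A i ≡ lookup B i
    row i = trans (sym (tabulate∘lookup (lookup A i)))
              (trans (tabulate-cong (same i)) (tabulate∘lookup (lookup B i)))

  bit-mono : {A B : Obj r N} → A ⊆ᵒ B → ∀ i j → bit A i j ≤ bit B i j
  bit-mono {A} {B} A⊆B i j = ≤-from-→ λ j∈A →
    []=⇒lookup (Pointwise.lookup A⊆B i (lookup⇒[]= j (lookup A i) j∈A))
    where
    ≤-from-→ : ∀ {a b} → (a ≡ true → b ≡ true) → a ≤ b
    ≤-from-→ {false} {false} _ = b≤b
    ≤-from-→ {false} {true}  _ = f≤t
    ≤-from-→ {true}          f rewrite f refl = b≤b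

  ⊆-by-bits : {A B : Obj r N} → (∀ i j → bit A i j ≤ bit B i j) → A ⊆ᵒ B
  ⊆-by-bits {A} {B} le = subst₂ (Pointwise.Pointwise S._⊆_) (tabulate∘lookup A) (tabulate∘lookup B)
    (Pointwise.tabulate⁺ λ i {j} j∈A → lookup⇒[]= j (lookup B i) (up (le i j) ([]=⇒lookup j∈A)))
    where
    up : ∀ {a b} → a ≤ b → a ≡ true → b ≡ true
    up b≤b refl = refl

  ⊆ᵒ-refl : {A : Obj r N} → A ⊆ᵒ A
  ⊆ᵒ-refl = ⊆-by-bits λ i j → ≤-refl

  ⊆ᵒ-trans : {A B C : Obj r N} → A ⊆ᵒ B → B ⊆ᵒ C → A ⊆ᵒ C
  ⊆ᵒ-trans A⊆B B⊆C = ⊆-by-bits λ i j → ≤-trans (bit-mono A⊆B i j) (bit-mono B⊆C i j)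

  ⊆ᵒ-antisym : {A B : Obj r N} → A ⊆ᵒ B → B ⊆ᵒ A → A ≡ B
  ⊆ᵒ-antisym A⊆B B⊆A = obj-ext λ i j → ≤-antisym (bit-mono A⊆B i j) (bit-mono B⊆A i j)

  ∅-⊆ : {A : Obj r N} → ∅ᵒ ⊆ᵒ A
  ∅-⊆ {A} = ⊆-by-bits λ i j → subst (_≤ bit A i j) (sym (bit-∅ i j)) (≤-minimum (bit A i j))

  ⊆∅ : {A : Obj r N} → A ⊆ᵒ ∅ᵒ → A ≡ ∅ᵒ
  ⊆∅ A⊆∅ = ⊆ᵒ-antisym A⊆∅ ∅-⊆

  ─-⊆ : (A B : Obj r N) → (A -ᵒ B) ⊆ᵒ A
  ─-⊆ A B = ⊆-by-bits λ i j → subst (_≤ bit A i j) (sym (bit-─ A B i j)) (law (bit A i j) (bit B i j))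
    where
    law : ∀ a b → a ∧ not b ≤ a
    law false _    = b≤b
    law true false = b≤b
    law true true  = f≤t

  ∩-⊆ˡ : (A B : Obj r N) → (A ∩ᵒ B) ⊆ᵒ A
  ∩-⊆ˡ A B = ⊆-by-bits λ i j → subst (_≤ bit A i j) (sym (bit-∩ A B i j)) (law (bit A i j) (bit B i j))
    where
    law : ∀ a b → a ∧ b ≤ a
    law false _    = b≤b
    law true false = f≤t
    law true true  = b≤b

  ∩-⊆ʳ : (A B : Obj r N) → (A ∩ᵒ B) ⊆ᵒ B
  ∩-⊆ʳ A B = ⊆-by-bits λ i j → subst (_≤ bit B i j) (sym (bit-∩ A B i j)) (law (bit A i j) (bit B i j))
    where
    law : ∀ a b → a ∧ b ≤ b
    law false _ = ≤-minimum _
    law true  _ = b≤b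

  disjoint-bits : {A B : Obj r N} → Disjoint A B → ∀ i j → bit A i j ∧ bit B i j ≡ false
  disjoint-bits {A} {B} A#B i j = trans (sym (bit-∩ A B i j)) (trans (cong (λ X → bit X i j) A#B) (bit-∅ i j))

  disjoint-by-bits : {A B : Obj r N} → (∀ i j → bit A i j ∧ bit B i j ≡ false) → Disjoint A B
  disjoint-by-bits {A} {B} none = obj-ext λ i j → trans (bit-∩ A B i j) (trans (none i j) (sym (bit-∅ i j)))

  disjoint-sym : {A B : Obj r N} → Disjoint A B → Disjoint B A
  disjoint-sym {A} {B} A#B = disjoint-by-bits λ i j →
    trans (∧-comm (bit B i j) (bit A i j)) (disjoint-bits A#B i j)

  disjoint-⊆ : {I A B : Obj r N} → I ⊆ᵒ A → Disjoint A B → Disjoint I B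
  disjoint-⊆ {I} {A} {B} I⊆A A#B = disjoint-by-bits λ i j →
    law (bit-mono I⊆A i j) (disjoint-bits A#B i j)
    where
    law : ∀ {x a b} → x ≤ a → a ∧ b ≡ false → x ∧ b ≡ false
    law f≤t _ = refl
    law b≤b p = p

  disjoint-─ : (Ω Y : Obj r N) → Disjoint Y (Ω -ᵒ Y)
  disjoint-─ Ω Y = disjoint-by-bits λ i j →
    trans (cong (bit Y i j ∧_) (bit-─ Ω Y i j)) (law (bit Y i j) (bit Ω i j))
    where
    law : ∀ y o → y ∧ (o ∧ not y) ≡ false
    law false _ = refl
    law true  o = ∧-zeroʳ o

  disjoint-∅ : (X : Obj r N) → Disjoint ∅ᵒ X
  disjoint-∅ X = disjoint-by-bits λ i j → cong (_∧ bit X i j) (bit-∅ i j)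

  ─≡∅⇒⊆ : {A B : Obj r N} → A -ᵒ B ≡ ∅ᵒ → A ⊆ᵒ B
  ─≡∅⇒⊆ {A} {B} A─B≡∅ = ⊆-by-bits λ i j →
    law (bit A i j) (bit B i j) (trans (sym (bit-─ A B i j)) (trans (cong (λ X → bit X i j) A─B≡∅) (bit-∅ i j)))
    where
    law : ∀ a b → a ∧ not b ≡ false → a ≤ b
    law false _     _ = ≤-minimum _
    law true  true  _ = b≤b

  ⊆-─ : {A Y C : Obj r N} → A ⊆ᵒ Y → Disjoint A C → A ⊆ᵒ (Y -ᵒ C)
  ⊆-─ {A} {Y} {C} A⊆Y A#C = ⊆-by-bits λ i j →
    subst (bit A i j ≤_) (sym (bit-─ Y C i j)) (law (bit-mono A⊆Y i j) (disjoint-bits A#C i j))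
    where
    law : ∀ {a y c} → a ≤ y → a ∧ c ≡ false → a ≤ y ∧ not c
    law {false} _ _ = ≤-minimum _
    law {true} {c = false} b≤b _ = b≤b

  -- Identities identifying the four pieces produced by (D1) with the sets
  -- the argument works with.
  ∪-identityˡ : (X : Obj r N) → ∅ᵒ ∪ᵒ X ≡ X
  ∪-identityˡ X = obj-ext λ i j → trans (bit-∪ ∅ᵒ X i j) (cong (_∨ bit X i j) (bit-∅ i j))

  ∪-─ : {Y Ω : Obj r N} → Y ⊆ᵒ Ω → Y ∪ᵒ (Ω -ᵒ Y) ≡ Ω
  ∪-─ {Y} {Ω} Y⊆Ω = obj-ext pointwise
    where
    law : ∀ {y o} → y ≤ o → y ∨ (o ∧ not y) ≡ o
    law {false} {o} _ = ∧-identityʳ o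
    law {true} b≤b = refl
    pointwise : ∀ i j → bit (Y ∪ᵒ (Ω -ᵒ Y)) i j ≡ bit Ω i j
    pointwise i j rewrite bit-∪ Y (Ω -ᵒ Y) i j | bit-─ Ω Y i j = law (bit-mono Y⊆Ω i j)

  ∩-⊆ : {I A : Obj r N} → I ⊆ᵒ A → A ∩ᵒ I ≡ I
  ∩-⊆ {I} {A} I⊆A = obj-ext pointwise
    where
    law : ∀ {x a} → x ≤ a → a ∧ x ≡ x
    law {a = a} f≤t = refl
    law {false} b≤b = refl
    law {true}  b≤b = refl
    pointwise : ∀ i j → bit (A ∩ᵒ I) i j ≡ bit I i j
    pointwise i j rewrite bit-∩ A I i j = law (bit-mono I⊆A i j)

  ∩-─ : {A Ω : Obj r N} (I : Obj r N) → A ⊆ᵒ Ω → A ∩ᵒ (Ω -ᵒ I) ≡ A -ᵒ I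
  ∩-─ {A} {Ω} I A⊆Ω = obj-ext pointwise
    where
    law : ∀ {a o} x → a ≤ o → a ∧ (o ∧ not x) ≡ a ∧ not x
    law x f≤t = refl
    law {false} x b≤b = refl
    law {true}  x b≤b = refl
    pointwise : ∀ i j → bit (A ∩ᵒ (Ω -ᵒ I)) i j ≡ bit (A -ᵒ I) i j
    pointwise i j rewrite bit-∩ A (Ω -ᵒ I) i j | bit-─ Ω I i j | bit-─ A I i j =
      law (bit I i j) (bit-mono A⊆Ω i j)

  ─-disjoint : {A I : Obj r N} → Disjoint A I → A -ᵒ I ≡ A
  ─-disjoint {A} {I} A#I = obj-ext pointwise
    where
    law : ∀ a x → a ∧ x ≡ false → a ∧ not x ≡ a
    law false _     _ = refl
    law true  false _ = refl
    pointwise : ∀ i j → bit (A -ᵒ I) i j ≡ bit A i j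
    pointwise i j rewrite bit-─ A I i j = law (bit A i j) (bit I i j) (disjoint-bits A#I i j)

  ─-∩ : (A B : Obj r N) → A -ᵒ (A ∩ᵒ B) ≡ A -ᵒ B
  ─-∩ A B = obj-ext pointwise
    where
    law : ∀ a b → a ∧ not (a ∧ b) ≡ a ∧ not b
    law false _ = refl
    law true  _ = refl
    pointwise : ∀ i j → bit (A -ᵒ (A ∩ᵒ B)) i j ≡ bit (A -ᵒ B) i j
    pointwise i j rewrite bit-─ A (A ∩ᵒ B) i j | bit-∩ A B i j | bit-─ A B i j = law (bit A i j) (bit B i j)

  ─-comm : (Y C A : Obj r N) → (Y -ᵒ C) -ᵒ A ≡ (Y -ᵒ A) -ᵒ C
  ─-comm Y C A = obj-ext pointwise
    where
    law : ∀ y c a → (y ∧ not c) ∧ not a ≡ (y ∧ not a) ∧ not c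
    law false _ _ = refl
    law true  c a = ∧-comm (not c) (not a)
    pointwise : ∀ i j → bit ((Y -ᵒ C) -ᵒ A) i j ≡ bit ((Y -ᵒ A) -ᵒ C) i j
    pointwise i j rewrite bit-─ (Y -ᵒ C) A i j | bit-─ (Y -ᵒ A) C i j | bit-─ Y C i j | bit-─ Y A i j =
      law (bit Y i j) (bit C i j) (bit A i j)

Fin-injective⇒onto : ∀ {n} (f : Fin n → Fin n) → Injective _≡_ _≡_ f → ∀ y → ∃[ i ] f i ≡ y
Fin-injective⇒onto {suc n} f f-inj y with any? (λ i → f i ≟ y)
... | yes hit = hit
... | no miss = contradiction (injective⇒≤ squeeze-injective) ℕ.1+n≰n
  where
  avoids : ∀ i → y ≢ f i
  avoids i y≡fi = miss (i , sym y≡fi)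
  -- f misses y, so it factors injectively through Fin (suc n) − {y} ≅ Fin n
  squeeze : Fin (suc n) → Fin n
  squeeze i = punchOut (avoids i)
  squeeze-injective : Injective _≡_ _≡_ squeeze
  squeeze-injective eq = f-inj (punchOut-injective (avoids _) (avoids _) eq)

finite-injective⇒onto : {A : Set} {n : ℕ} → A ↔ Fin n →
                        (h : A → A) → Injective _≡_ _≡_ h → ∀ t → ∃[ u ] h u ≡ t
finite-injective⇒onto {n = n} A↔Fin h h-inj t =
  map from to-injective (Fin-injective⇒onto conjugate conjugate-injective (to t))
  where
  open Inverse A↔Fin using (to; from)
  to-injective : Injective _≡_ _≡_ to
  to-injective = Injection.injective (↔⇒↣ A↔Fin)
  conjugate : Fin n → Fin n
  conjugate i = to (h (from i))
  conjugate-injective : Injective _≡_ _≡_ conjugate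
  conjugate-injective eq = Injection.injective (↔⇒↣ (↔-sym A↔Fin)) (h-inj (to-injective eq))

module Atoms {r N : ℕ} (Sp : Species r N) (C : CompositionOperator Sp) where
  open Species Sp
  open CompositionOperator C
  open Derived Sp C

  Composite : (Ω I J : Obj r N) → F₀ Ω → Set
  Composite Ω I J = Img F₀ η Ω I J Full Full

  Composite-cong : {Ω I J I' J' : Obj r N} {x : F₀ Ω} → I ≡ I' → J ≡ J' →
                   Composite Ω I J x → Composite Ω I' J' x
  Composite-cong refl refl x-comp = x-comp

  Splits : (Ω : Obj r N) → F₀ Ω → Obj r N → Set
  Splits Ω x Y = Composite Ω Y (Ω -ᵒ Y) x

  Presentation : (Ω X : Obj r N) → F₀ X → F₀ (Ω -ᵒ X) → F₀ Ω → Set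
  Presentation Ω X c c' x =
    Σ[ d ∈ Disjoint X (Ω -ᵒ X) ] Σ[ e ∈ X ∪ᵒ (Ω -ᵒ X) ≡ Ω ] subst F₀ e (η d c c') ≡ x

  -- The factors of x along a fixed pair (I , J) are unique; the proofs of
  -- I ∪ J ≡ Ω agree because equality of objects is decidable.
  factors-unique : {Ω I J : Obj r N} (d d' : Disjoint I J) (e e' : I ∪ᵒ J ≡ Ω)
                   {a a' : F₀ I} {b b' : F₀ J} →
                   subst F₀ e (η d a b) ≡ subst F₀ e' (η d' a' b') → (a ≡ a') × (b ≡ b')
  factors-unique d d' e e' same with Decidable⇒UIP.≡-irrelevant _≟ᵒ_ e e'
  ... | refl = η-injective d (subst-injective e same)

  factors-split : {Ω X Y : Obj r N} {c : F₀ X} {c' : F₀ (Ω -ᵒ X)} {x : F₀ Ω} →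
    Presentation Ω X c c' x → Splits Ω x Y →
    Composite X (X ∩ᵒ Y) (X ∩ᵒ (Ω -ᵒ Y)) c ×
    Composite (Ω -ᵒ X) ((Ω -ᵒ X) ∩ᵒ Y) ((Ω -ᵒ X) ∩ᵒ (Ω -ᵒ Y)) c'
  factors-split {x = x} (d , e , p) Y-splits@(dY , eY , _)
    with Equivalence.to (D1 d e dY eY x) ((d , e , _ , _ , tt , tt , p) , Y-splits)
  ... | d₂ , e₂ , _ , _ , c-splits , c'-splits , p₂
    with factors-unique d d₂ e e₂ (trans p (sym p₂))
  ... | refl , refl = c-splits , c'-splits

  split-from-factors : {Ω X Y : Obj r N} {c : F₀ X} {c' : F₀ (Ω -ᵒ X)} {x : F₀ Ω} →
    Presentation Ω X c c' x → Y ⊆ᵒ Ω →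
    Composite X (X ∩ᵒ Y) (X ∩ᵒ (Ω -ᵒ Y)) c →
    Composite (Ω -ᵒ X) ((Ω -ᵒ X) ∩ᵒ Y) ((Ω -ᵒ X) ∩ᵒ (Ω -ᵒ Y)) c' → Splits Ω x Y
  split-from-factors {Ω} {Y = Y} {x = x} (d , e , p) Y⊆Ω c-splits c'-splits =
    proj₂ (Equivalence.from (D1 d e (disjoint-─ Ω Y) (∪-─ Y⊆Ω) x)
                            (d , e , _ , _ , c-splits , c'-splits , p))

  -- Given e₀ ∈ F[∅], every c ∈ F[X] is η(e₀, u) for some u, because
  -- u ↦ η(e₀, u) is an injective map of the finite set F[X] to itself.
  split-off-∅ : F₀ ∅ᵒ → {X I J : Obj r N} → I ≡ ∅ᵒ → J ≡ X → (c : F₀ X) → Composite X I J c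
  split-off-∅ e₀ {X} refl refl c =
    let u , hit = finite-injective⇒onto (proj₂ (finite X)) prefix prefix-injective c
    in disjoint-∅ X , ∪-identityˡ X , e₀ , u , tt , tt , hit
    where
    prefix : F₀ X → F₀ X
    prefix u = subst F₀ (∪-identityˡ X) (η (disjoint-∅ X) e₀ u)
    prefix-injective : ∀ {u v} → prefix u ≡ prefix v → u ≡ v
    prefix-injective eq = proj₂ (η-injective (disjoint-∅ X) (subst-injective (∪-identityˡ X) eq))

  -- Splitting sets are closed under intersection: writing x = η(c, c')
  -- along A, the factor c splits along A ∩ B by (D1), while c' is split
  -- trivially as η(e₀, c'), since Ω − A misses A ∩ B.
  splits-∩ : F₀ ∅ᵒ → {Ω A B : Obj r N} {x : F₀ Ω} → A ⊆ᵒ Ω →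
             Splits Ω x A → Splits Ω x B → Splits Ω x (A ∩ᵒ B)
  splits-∩ e₀ {Ω} {A} {B} A⊆Ω (d , e , c , c' , _ , _ , p) B-splits =
    split-from-factors presentation (⊆ᵒ-trans (∩-⊆ˡ A B) A⊆Ω)
      (Composite-cong (sym (∩-⊆ (∩-⊆ˡ A B))) (sym A-trace) (proj₁ (factors-split presentation B-splits)))
      (split-off-∅ e₀ outside-A outside-A′ c')
    where
    presentation : Presentation Ω A c c' _
    presentation = d , e , p
    A-trace : A ∩ᵒ (Ω -ᵒ (A ∩ᵒ B)) ≡ A ∩ᵒ (Ω -ᵒ B)
    A-trace = trans (∩-─ (A ∩ᵒ B) A⊆Ω) (trans (─-∩ A B) (sym (∩-─ B A⊆Ω)))
    outside-A : Disjoint (Ω -ᵒ A) (A ∩ᵒ B)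
    outside-A = disjoint-sym (disjoint-⊆ (∩-⊆ˡ A B) (disjoint-─ Ω A))
    outside-A′ : (Ω -ᵒ A) ∩ᵒ (Ω -ᵒ (A ∩ᵒ B)) ≡ Ω -ᵒ A
    outside-A′ = trans (∩-─ (A ∩ᵒ B) (─-⊆ Ω A)) (─-disjoint outside-A)

  record Atom (Ω : Obj r N) (x : F₀ Ω) (B : Obj r N) : Set where
    field
      inside   : B ⊆ᵒ Ω
      nonempty : B ≢ ∅ᵒ
      splits   : Splits Ω x B
      minimal  : ∀ I → I ⊆ᵒ B → I ≢ ∅ᵒ → B -ᵒ I ≢ ∅ᵒ → ¬ Splits Ω x I
  open Atom

  atom-covered : {Ω B I : Obj r N} {x : F₀ Ω} → Atom Ω x B →
                 I ⊆ᵒ B → I ≢ ∅ᵒ → Splits Ω x I → B ⊆ᵒ I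
  atom-covered {B = B} {I} B-atom I⊆B I≢∅ I-splits =
    ─≡∅⇒⊆ (decidable-stable ((B -ᵒ I) ≟ᵒ ∅ᵒ) λ B─I≢∅ → minimal B-atom I I⊆B I≢∅ B─I≢∅ I-splits)

  atom-⊈∅ : {Ω A X : Obj r N} {x : F₀ Ω} → Atom Ω x A → A ⊆ᵒ X → X ≡ ∅ᵒ → ⊥
  atom-⊈∅ A-atom A⊆X refl = nonempty A-atom (⊆∅ A⊆X)

  atoms-equal-or-disjoint : F₀ ∅ᵒ → {Ω A B : Obj r N} {x : F₀ Ω} →
                            Atom Ω x A → Atom Ω x B → (A ≡ B) ⊎ Disjoint A B
  atoms-equal-or-disjoint e₀ {A = A} {B} A-atom B-atom with (A ∩ᵒ B) ≟ᵒ ∅ᵒ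
  ... | yes A#B = inj₂ A#B
  ... | no A∩B≢∅ = inj₁ (⊆ᵒ-antisym
          (⊆ᵒ-trans (atom-covered A-atom (∩-⊆ˡ A B) A∩B≢∅ A∩B-splits) (∩-⊆ʳ A B))
          (⊆ᵒ-trans (atom-covered B-atom (∩-⊆ʳ A B) A∩B≢∅ A∩B-splits) (∩-⊆ˡ A B)))
    where
    A∩B-splits : Splits _ _ (A ∩ᵒ B)
    A∩B-splits = splits-∩ e₀ (inside A-atom) (splits A-atom) (splits B-atom)

  atomic-factor-atom : {Ω A : Obj r N} {a : F₀ A} {y : F₀ (Ω -ᵒ A)} {x : F₀ Ω} →
    Presentation Ω A a y x → A ⊆ᵒ Ω → Fη A a → Atom Ω x A
  atomic-factor-atom {A = A} presentation@(d , e , p) A⊆Ω (A≢∅ , a-indecomposable) = record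
    { inside   = A⊆Ω
    ; nonempty = A≢∅
    ; splits   = d , e , _ , _ , tt , tt , p
    ; minimal  = λ I I⊆A I≢∅ A─I≢∅ I-splits → a-indecomposable
        (I , A -ᵒ I , I≢∅ , A─I≢∅ ,
         Composite-cong (∩-⊆ I⊆A) (∩-─ I A⊆Ω) (proj₁ (factors-split presentation I-splits)))
    }

  record Residual (Ω : Obj r N) (x : F₀ Ω) (Ω' : Obj r N) (y : F₀ Ω') : Set where
    field
      within   : Ω' ⊆ᵒ Ω
      lift     : ∀ {I} → I ⊆ᵒ Ω' → Splits Ω' y I → Splits Ω x I
      restrict : ∀ {I} → I ⊆ᵒ Ω' → Splits Ω x I → Splits Ω' y I
  open Residual

  residual-refl : {Ω : Obj r N} {x : F₀ Ω} → Residual Ω x Ω x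
  residual-refl = record { within = ⊆ᵒ-refl ; lift = λ _ s → s ; restrict = λ _ s → s }

  residual-trans : {Ω Ω' Ω'' : Obj r N} {x : F₀ Ω} {y : F₀ Ω'} {z : F₀ Ω''} →
                   Residual Ω x Ω' y → Residual Ω' y Ω'' z → Residual Ω x Ω'' z
  residual-trans res res' = record
    { within   = ⊆ᵒ-trans (within res') (within res)
    ; lift     = λ I⊆Ω'' s → lift res (⊆ᵒ-trans I⊆Ω'' (within res')) (lift res' I⊆Ω'' s)
    ; restrict = λ I⊆Ω'' s → restrict res' I⊆Ω'' (restrict res (⊆ᵒ-trans I⊆Ω'' (within res')) s)
    }

  -- In a presentation y = η(a, y'), the second factor is a residual of y:
  -- a set I ⊆ Ω − A meets A trivially, so splitting y along I amounts to
  -- splitting y' along I (the factor a is split off as η(e₀, a)).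
  second-factor-residual : F₀ ∅ᵒ → {Ω A : Obj r N} {a : F₀ A} {y' : F₀ (Ω -ᵒ A)} {y : F₀ Ω} →
    Presentation Ω A a y' y → A ⊆ᵒ Ω → Residual Ω y (Ω -ᵒ A) y'
  second-factor-residual e₀ {Ω} {A} {a} presentation A⊆Ω = record
    { within   = ─-⊆ Ω A
    ; lift     = λ I⊆ s → split-from-factors presentation (⊆ᵒ-trans I⊆ (─-⊆ Ω A))
                   (split-off-∅ e₀ (A-misses I⊆) (A-trace I⊆) a)
                   (Composite-cong (sym (∩-⊆ I⊆)) (sym (∩-─ _ (─-⊆ Ω A))) s)
    ; restrict = λ I⊆ s → Composite-cong (∩-⊆ I⊆) (∩-─ _ (─-⊆ Ω A))
                   (proj₂ (factors-split presentation s))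
    }
    where
    A-misses : {I : Obj r N} → I ⊆ᵒ (Ω -ᵒ A) → Disjoint A I
    A-misses I⊆ = disjoint-sym (disjoint-⊆ I⊆ (disjoint-sym (disjoint-─ Ω A)))
    A-trace : {I : Obj r N} → I ⊆ᵒ (Ω -ᵒ A) → A ∩ᵒ (Ω -ᵒ I) ≡ A
    A-trace {I} I⊆ = trans (∩-─ I A⊆Ω) (─-disjoint (A-misses I⊆))

  atom-lift : {Ω Ω' B : Obj r N} {x : F₀ Ω} {y : F₀ Ω'} →
              Residual Ω x Ω' y → Atom Ω' y B → Atom Ω x B
  atom-lift res B-atom = record
    { inside   = ⊆ᵒ-trans (inside B-atom) (within res)
    ; nonempty = nonempty B-atom
    ; splits   = lift res (inside B-atom) (splits B-atom)
    ; minimal  = λ I I⊆B I≢∅ B─I≢∅ I-splits → minimal B-atom I I⊆B I≢∅ B─I≢∅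
                   (restrict res (⊆ᵒ-trans I⊆B (inside B-atom)) I-splits)
    }

  Partition : (Ω : Obj r N) → F₀ Ω → ℕ → Obj r N → Set
  Partition Ω x zero    X = X ≡ ∅ᵒ
  Partition Ω x (suc k) X = Σ[ A ∈ Obj r N ] Atom Ω x A × A ⊆ᵒ X × Partition Ω x k (X -ᵒ A)

  level⇒partition : F₀ ∅ᵒ → ∀ k {Ω Ω' : Obj r N} {x : F₀ Ω} {y : F₀ Ω'} →
                    Residual Ω x Ω' y → Fηᵏ k Ω' y → Partition Ω x k Ω'
  level⇒partition e₀ zero    res Ω'≡∅ = Ω'≡∅
  level⇒partition e₀ (suc k) {Ω' = Ω'} {y = y} res (A , A⊆Ω' , d , e , a , y' , a-atomic , y'-level , p) =
    A , atom-lift res (atomic-factor-atom presentation A⊆Ω' a-atomic) , A⊆Ω' ,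
    level⇒partition e₀ k (residual-trans res (second-factor-residual e₀ presentation A⊆Ω')) y'-level
    where
    presentation : Presentation Ω' A a y' y
    presentation = d , e , p

  partition-remove : F₀ ∅ᵒ → ∀ m {Ω Y A : Obj r N} {x : F₀ Ω} →
    Partition Ω x (suc m) Y → Atom Ω x A → A ⊆ᵒ Y → Partition Ω x m (Y -ᵒ A)
  partition-remove e₀ m (B , B-atom , B⊆Y , rest) A-atom A⊆Y
    with atoms-equal-or-disjoint e₀ A-atom B-atom
  ... | inj₁ refl = rest
  partition-remove e₀ zero (B , B-atom , B⊆Y , rest) A-atom A⊆Y | inj₂ A#B =
    ⊥-elim (atom-⊈∅ A-atom (⊆-─ A⊆Y A#B) rest)
  partition-remove e₀ (suc m) {Ω} {Y} {A} {x} (B , B-atom , B⊆Y , rest) A-atom A⊆Y | inj₂ A#B =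
    B , B-atom , ⊆-─ B⊆Y (disjoint-sym A#B) ,
    subst (Partition Ω x m) (─-comm Y B A) (partition-remove e₀ m rest A-atom (⊆-─ A⊆Y A#B))

  partition-size-unique : F₀ ∅ᵒ → ∀ k ℓ {Ω X : Obj r N} {x : F₀ Ω} →
                          Partition Ω x k X → Partition Ω x ℓ X → k ≡ ℓ
  partition-size-unique e₀ zero    zero    _ _ = refl
  partition-size-unique e₀ zero    (suc ℓ) X≡∅ (A , A-atom , A⊆X , _) = ⊥-elim (atom-⊈∅ A-atom A⊆X X≡∅)
  partition-size-unique e₀ (suc k) zero    (A , A-atom , A⊆X , _) X≡∅ = ⊥-elim (atom-⊈∅ A-atom A⊆X X≡∅)
  partition-size-unique e₀ (suc k) (suc ℓ) (A , A-atom , A⊆X , rest) other =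
    cong suc (partition-size-unique e₀ k ℓ rest (partition-remove e₀ ℓ other A-atom A⊆X))

  level⇒empty-value : ∀ k {Ω : Obj r N} {x : F₀ Ω} → Fηᵏ k Ω x → F₀ ∅ᵒ
  level⇒empty-value zero    {x = x} Ω≡∅ = subst F₀ Ω≡∅ x
  level⇒empty-value (suc k) (_ , _ , _ , _ , _ , _ , _ , y-level , _) = level⇒empty-value k y-level

-- Both levels unfold to atom partitions of Ω, which have the same size.
proposition2p3 : (r : ℕ) → 0 < r → (N : ℕ) (Sp : Species r N)
    (C : CompositionOperator Sp) (k ℓ : ℕ) → k ≢ ℓ →
    (Ω : Obj r N) (x : Species.F₀ Sp Ω) →
    Derived.Fηᵏ Sp C k Ω x → Derived.Fηᵏ Sp C ℓ Ω x → ⊥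
proposition2p3 r _ N Sp C k ℓ k≢ℓ Ω x x-at-k x-at-ℓ =
  k≢ℓ (partition-size-unique e₀ k ℓ (level⇒partition e₀ k residual-refl x-at-k)
                                    (level⇒partition e₀ ℓ residual-refl x-at-ℓ))
  where
  open Atoms Sp C
  e₀ : Species.F₀ Sp ∅ᵒ
  e₀ = level⇒empty-value k x-at-k
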